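{- Let $S$ be a finite set of sensors, each with a coverage interval $[u_s,v_s]\subset\mathbb{R}$, let $a<\beta_1<\beta_2$, and assume the union of the coverage intervals of the sensors in $S$ contains $[a,\beta_2]$. For $\beta>a$ let $S^g(a,\beta)$ denote the set of sensors selected by continuous OGA (defined in the context) to cover $[a,\beta]$. Then $|S^g(a,\beta_1)|\le|S^g(a,\beta_2)|$.
   Context: Continuous OGA for covering an interval $[a,\beta]$ with sensors whose coverage intervals are $[u_s,v_s]$: set the current point $p=a$; repeatedly select, among the not-yet-selected sensors whose interval contains $p$, one with the largest right endpoint $v_s$ (ties broken in favor of the longest interval), and set $p$ to that right endpoint; stop as soon as the selected right endpoint satisfies $p\ge\beta$. -}

module Defs where

open import Level using (Level; _⊔_)
open import Data.Nat using (ℕ)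
open import Data.Fin using (Fin)
open import Data.List using (List; []; _∷_)
open import Data.List.Membership.Propositional using (_∉_)
open import Data.Product using (_×_; ∃-syntax)
open import Data.Sum using (_⊎_)
open import Relation.Binary.Bundles using (StrictTotalOrder)
import Relation.Binary.Construct.StrictToNonStrict as NonStrict

-- Everything is stated over an arbitrary strict total order (the reals being
-- the intended instance); only the order of the endpoints matters.
module OGA {c ℓ₁ ℓ₂ : Level} (O : StrictTotalOrder c ℓ₁ ℓ₂) where
  open StrictTotalOrder O public
  A = Carrier
  open NonStrict _≈_ _<_ using (_≤_) public

  Dense : Set (c ⊔ ℓ₂)
  Dense = ∀ x y → x < y → ∃[ z ] (x < z × z < y)

  -- n sensors, sensor s has coverage interval [ u s , v s ]
  module _ {n : ℕ} (u v : Fin n → A) where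

    _∈I_ : A → Fin n → Set (ℓ₁ ⊔ ℓ₂)
    x ∈I s = u s ≤ x × x ≤ v s

    Covers : A → A → Set (c ⊔ ℓ₁ ⊔ ℓ₂)
    Covers a b = ∀ x → a ≤ x → x ≤ b → ∃[ s ] (x ∈I s)

    -- Remaining ties are arbitrary.
    Greedy : List (Fin n) → A → Fin n → Set (ℓ₁ ⊔ ℓ₂)
    Greedy sel p s =
      s ∉ sel × p ∈I s ×
      (∀ t → t ∉ sel → p ∈I t → v t < v s ⊎ (v t ≈ v s × u s ≤ u t))

    -- OGARun β sel p out : continuous OGA for covering up to β, started at
    -- current point p with already selected sensors sel, terminates with the
    -- selected set out (the most recently selected sensor first).
    data OGARun (β : A) : List (Fin n) → A → List (Fin n) → Set (c ⊔ ℓ₁ ⊔ ℓ₂) where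
      stop : ∀ {sel p s} → Greedy sel p s → β ≤ v s →
             OGARun β sel p (s ∷ sel)
      next : ∀ {sel p s out} → Greedy sel p s → v s < β →
             OGARun β (s ∷ sel) (v s) out → OGARun β sel p out

    SelectedBy : A → A → List (Fin n) → Set (c ⊔ ℓ₁ ⊔ ℓ₂)
    SelectedBy a β out = OGARun β [] a out

-- Both runs start at a, and as long as neither has stopped they stay at the
-- same current point.  Every sensor selected so far ends at or before the
-- current point p, so it is no competitor for a sensor reaching beyond p; hence
-- the greedy choice at p reaches the same right endpoint in both runs,
-- whichever sensors they chose.  The run towards β₁ therefore stops no later
-- than the run towards β₂, having selected no more sensors.
module Submission where

open import Defs
open import Level using (Level; _⊔_)
open import Data.Nat using (ℕ; suc; s≤s; z≤n) renaming (_≤_ to _≤ℕ_)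
open import Data.Nat.Properties using (<⇒≤) renaming (≤-refl to ≤ℕ-refl; ≤-trans to ≤ℕ-trans)
open import Data.Fin using (Fin)
open import Data.Fin.Properties using () renaming (_≟_ to _≟ᶠ_)
open import Data.List using (List; length; _∷_)
open import Data.List.Membership.Propositional using (_∈_)
import Data.List.Membership.DecPropositional as DecMembership
open import Data.List.Relation.Unary.Any using (here; there)
open import Data.Product using (_,_)
open import Data.Sum using (inj₁; inj₂)
open import Data.Empty using (⊥-elim)
open import Relation.Nullary using (yes; no)
open import Relation.Binary.Bundles using (StrictTotalOrder; DecTotalOrder)
open import Relation.Binary.PropositionalEquality using (refl)
import Relation.Binary.Properties.StrictTotalOrder as StrictTotalOrderProperties
import Relation.Binary.Reasoning.StrictPartialOrder as StrictReasoning

module _ {c ℓ₁ ℓ₂ : Level} (O : StrictTotalOrder c ℓ₁ ℓ₂) where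
  open OGA O
  open DecTotalOrder (StrictTotalOrderProperties.decTotalOrder O)
    using (total; antisym; ≤-respʳ-≈) renaming (trans to ≤-trans)
  open StrictReasoning strictPartialOrder

  module _ {n : ℕ} (u v : Fin n → A) where
    open DecMembership (_≟ᶠ_ {n}) using (_∈?_)

    EndsBelow : List (Fin n) → A → Set (ℓ₁ ⊔ ℓ₂)
    EndsBelow sel p = ∀ t → t ∈ sel → v t ≤ p

    EndsBelow-∷ : ∀ {sel p s} → EndsBelow sel p → p ≤ v s → EndsBelow (s ∷ sel) (v s)
    EndsBelow-∷ below p≤vs t (here refl) = inj₂ Eq.refl
    EndsBelow-∷ below p≤vs t (there t∈) = ≤-trans (below t t∈) p≤vs

    Greedy⇒EndsBelow-∷ : ∀ {sel p s} → EndsBelow sel p → Greedy u v sel p s →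
                         EndsBelow (s ∷ sel) (v s)
    Greedy⇒EndsBelow-∷ below (_ , (_ , p≤vs) , _) = EndsBelow-∷ below p≤vs

    Greedy-end-≤ : ∀ {sel₁ sel₂ p₁ p₂ s₁ s₂} →
                   Greedy u v sel₁ p₁ s₁ → Greedy u v sel₂ p₂ s₂ →
                   p₁ ≈ p₂ → EndsBelow sel₂ p₂ → v s₁ ≤ v s₂
    Greedy-end-≤ {sel₂ = sel₂} {p₂ = p₂} {s₁} (_ , (us₁≤p₁ , _) , _) (_ , (_ , p₂≤vs₂) , best₂) p₁≈p₂ below
      with s₁ ∈? sel₂
    ... | yes s₁∈ = ≤-trans (below s₁ s₁∈) p₂≤vs₂
    ... | no s₁∉ with total (v s₁) p₂
    ...   | inj₁ vs₁≤p₂ = ≤-trans vs₁≤p₂ p₂≤vs₂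
    ...   | inj₂ p₂≤vs₁ with best₂ s₁ s₁∉ (≤-respʳ-≈ p₁≈p₂ us₁≤p₁ , p₂≤vs₁)
    ...     | inj₁ vs₁<vs₂ = inj₁ vs₁<vs₂
    ...     | inj₂ (vs₁≈vs₂ , _) = inj₂ vs₁≈vs₂

    OGARun-length : ∀ {β sel p out} → OGARun u v β sel p out → suc (length sel) ≤ℕ length out
    OGARun-length (stop _ _) = ≤ℕ-refl
    OGARun-length (next _ _ run) = <⇒≤ (OGARun-length run)

    OGARun-length-mono : ∀ {β₁ β₂ sel₁ sel₂ p₁ p₂ out₁ out₂} → β₁ < β₂ →
                         OGARun u v β₁ sel₁ p₁ out₁ → OGARun u v β₂ sel₂ p₂ out₂ →
                         p₁ ≈ p₂ → EndsBelow sel₁ p₁ → EndsBelow sel₂ p₂ →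
                         length sel₁ ≤ℕ length sel₂ → length out₁ ≤ℕ length out₂
    OGARun-length-mono _ (stop _ _) run₂ _ _ _ sel₁≤sel₂ =
      ≤ℕ-trans (s≤s sel₁≤sel₂) (OGARun-length run₂)
    OGARun-length-mono {β₂ = β₂} β₁<β₂ (next g₁ vs₁<β₁ _) (stop g₂ β₂≤vs₂) p₁≈p₂ below₁ _ _ =
      ⊥-elim (irrefl Eq.refl (begin-strict
        β₂   ≤⟨ β₂≤vs₂ ⟩
        _    ≤⟨ Greedy-end-≤ g₂ g₁ (Eq.sym p₁≈p₂) below₁ ⟩
        _    <⟨ vs₁<β₁ ⟩
        _    <⟨ β₁<β₂ ⟩
        β₂   ∎))
    OGARun-length-mono β₁<β₂ (next g₁ _ run₁) (next g₂ _ run₂) p₁≈p₂ below₁ below₂ sel₁≤sel₂ =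
      OGARun-length-mono β₁<β₂ run₁ run₂
        (antisym (Greedy-end-≤ g₁ g₂ p₁≈p₂ below₂) (Greedy-end-≤ g₂ g₁ (Eq.sym p₁≈p₂) below₁))
        (Greedy⇒EndsBelow-∷ below₁ g₁) (Greedy⇒EndsBelow-∷ below₂ g₂) (s≤s sel₁≤sel₂)

lemma2 : {c ℓ₁ ℓ₂ : Level} (O : StrictTotalOrder c ℓ₁ ℓ₂) →
    let open OGA O in
    Dense →
    (n : ℕ) (u v : Fin n → Carrier) (a β₁ β₂ : Carrier) →
    a < β₁ → β₁ < β₂ → Covers u v a β₂ →
    (S₁ S₂ : List (Fin n)) →
    SelectedBy u v a β₁ S₁ → SelectedBy u v a β₂ S₂ →
    length S₁ ≤ℕ length S₂
lemma2 O _ n u v a β₁ β₂ _ β₁<β₂ _ S₁ S₂ run₁ run₂ =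
  OGARun-length-mono O u v β₁<β₂ run₁ run₂ Eq.refl (λ _ ()) (λ _ ()) z≤n
  where open StrictTotalOrder O using (module Eq)
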